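{- Let $n$ be a nonnegative integer. For all indices $\boldsymbol{k}$ and $\boldsymbol{l}$, \[\sigma_n(\boldsymbol{k}*\boldsymbol{l})=\sum_{i=0}^n\sigma_i(\boldsymbol{k})*\sigma_{n-i}(\boldsymbol{l}).\]
   Context: An index is a finite sequence of positive integers, including the empty sequence $\emptyset$. Let $\mathcal{I}$ be the $\mathbb{Q}$-vector space with basis the indices. The harmonic product $*$ is the $\mathbb{Q}$-bilinear product on $\mathcal{I}$ defined inductively by $\emptyset*\boldsymbol{k}=\boldsymbol{k}*\emptyset=\boldsymbol{k}$ and $(\boldsymbol{k},k)*(\boldsymbol{l},l)=(\boldsymbol{k}*(\boldsymbol{l},l),k)+((\boldsymbol{k},k)*\boldsymbol{l},l)+(\boldsymbol{k}*\boldsymbol{l},k+l)$, where $(\cdot,k)$ appends $k$ to each index of a linear combination. For $n\ge0$, $\sigma_n:\mathcal{I}\to\mathcal{I}$ is the $\mathbb{Q}$-linear map with $\sigma_n(k_1,\dots,k_r)=\sum_{l_1+\dots+l_r=n,\ l_i\ge0}(k_1+l_1,\dots,k_r+l_r)\prod_{i=1}^r\binom{k_i+l_i-1}{l_i}$ and $\sigma_n(\emptyset)=\delta_{n,0}$ (Kronecker delta, i.e. $\emptyset$ if $n=0$ and $0$ otherwise). -}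

module Defs where

open import Data.Nat as ℕ using (ℕ; zero; suc; _∸_; NonZero)
open import Data.Nat.Combinatorics using (_C_)
open import Data.Integer using (+_)
open import Data.Rational as ℚ using (ℚ; _/_; 0ℚ; 1ℚ)
open import Data.List using (List; []; _∷_; _++_; map; reverse; concatMap; foldr; upTo; [_])
open import Data.List.Properties using (≡-dec)
open import Data.List.Relation.Unary.All using (All)
open import Data.Product using (_×_; _,_)
open import Relation.Binary.PropositionalEquality using (_≡_)
open import Relation.Nullary using (yes; no)

-- An index (k₁,…,k_r) is a list of natural numbers, written in the usual
-- left-to-right order; positivity of the entries is a separate predicate.
Index : Set
Index = List ℕ

IsIndex : Index → Set
IsIndex = All NonZero

-- Elements of the ℚ-vector space 𝓘 with basis the indices:
-- formal finite linear combinations  Σ q·k  (a list of (coefficient, index)).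
LC : Set
LC = List (ℚ × Index)

coeff : LC → Index → ℚ
coeff [] w = 0ℚ
coeff ((q , v) ∷ xs) w with ≡-dec ℕ._≟_ v w
... | yes _ = q ℚ.+ coeff xs w
... | no  _ = coeff xs w

_≈_ : LC → LC → Set
x ≈ y = ∀ w → coeff x w ≡ coeff y w

infix 4 _≈_

basis : Index → LC
basis k = [ (1ℚ , k) ]

scale : ℚ → LC → LC
scale q = map (λ { (p , v) → (q ℚ.* p , v) })

fromℕℚ : ℕ → ℚ
fromℕℚ n = (+ n) / 1

-- Harmonic product on indices.  We work on reversed lists (head = last entry)
-- so that "(k , k)" (appending k at the end) is  k ∷ _.
private
  consAll : ℕ → LC → LC
  consAll a = map (λ { (q , v) → (q , a ∷ v) })

  harmRev : Index → Index → LC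
  harmRev [] l = basis l
  harmRev (a ∷ k) [] = basis (a ∷ k)
  harmRev (a ∷ k) (b ∷ l) =
    consAll a (harmRev k (b ∷ l)) ++
    (consAll b (harmRev (a ∷ k) l) ++
     consAll (a ℕ.+ b) (harmRev k l))

  revAll : LC → LC
  revAll = map (λ { (q , v) → (q , reverse v) })

harmIdx : Index → Index → LC
harmIdx k l = revAll (harmRev (reverse k) (reverse l))

_*_ : LC → LC → LC
x * y = concatMap (λ { (p , k) → concatMap (λ { (q , l) → scale (p ℚ.* q) (harmIdx k l) }) y }) x

infixl 7 _*_

-- σ_n on a single index:
-- σ_n(k₁,…,k_r) = Σ_{l₁+…+l_r=n, lᵢ≥0} Π binom(kᵢ+lᵢ-1, lᵢ) (k₁+l₁,…,k_r+l_r),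
-- σ_n(∅) = δ_{n,0} ∅.
σIdx : ℕ → Index → LC
σIdx zero [] = basis []
σIdx (suc n) [] = []
σIdx n (k ∷ ks) =
  concatMap (λ j → scale (fromℕℚ ((k ℕ.+ j ∸ 1) C j))
                         (map (λ { (q , v) → (q , (k ℕ.+ j) ∷ v) }) (σIdx (n ∸ j) ks)))
            (upTo (suc n))

σ : ℕ → LC → LC
σ n = concatMap (λ { (q , k) → scale q (σIdx n k) })

sumLC : ℕ → (ℕ → LC) → LC
sumLC n f = concatMap f (upTo (suc n))

{-# OPTIONS --safe #-}
module Submission where

open import Defs
open import Data.Nat using (ℕ; zero; suc; _∸_; _+_)
import Data.Nat.Properties as ℕ
open import Data.Nat.Combinatorics using (_C_; k>n⇒nCk≡0; nCk+nC[k+1]≡[n+1]C[k+1])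
open import Data.Nat.Coprimality using (1-coprimeTo) renaming (sym to coprime-sym)
open import Data.Integer as ℤ using (+_)
import Data.Integer.Properties as ℤ
open import Data.Rational using (ℚ; 0ℚ; 1ℚ; mkℚ; _/_) renaming (_+_ to _+ℚ_; _*_ to _*ℚ_)
open import Data.Rational.Properties as ℚ
  using (+-assoc; +-comm; +-identityˡ; +-identityʳ; *-assoc; *-comm; *-identityˡ; *-identityʳ; *-zeroˡ; *-zeroʳ;
         *-distribˡ-+; +-0-commutativeMonoid; *-1-commutativeMonoid)
open import Algebra.Bundles using (CommutativeMonoid)
open import Algebra.Properties.CommutativeSemigroup (CommutativeMonoid.commutativeSemigroup +-0-commutativeMonoid)
  using () renaming (interchange to +-interchange)
open import Algebra.Properties.CommutativeSemigroup (CommutativeMonoid.commutativeSemigroup *-1-commutativeMonoid)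
  using () renaming (x∙yz≈y∙xz to *-leftComm)
open import Algebra.Properties.CommutativeSemigroup ℕ.+-commutativeSemigroup
  using () renaming (interchange to ℕ-+-interchange)
open import Data.List using ([]; _∷_; _++_; map; reverse; concatMap; applyUpTo; _∷ʳ_; [_])
open import Data.List.Properties using (≡-dec; map-++; reverse-++; reverse-involutive; reverse-selfInverse; unfold-reverse)
open import Data.List.Reverse using (Reverse; []; _∶_∶ʳ_; reverseView)
open import Data.Product using (_×_; _,_; proj₁; proj₂)
open import Function using (id; _∘_; flip)
open import Relation.Nullary using (yes; no)
open import Relation.Binary.PropositionalEquality hiding ([_])
open ≡-Reasoning

-- Pair a linear combination x with a test function g : Index → ℚ, ⟪ x , g ⟫ = Σ q·g(v). Since
-- coefficients are pairings with indicator functions, it suffices to prove, with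
-- σᵀ n g w = ⟪ σ_n w , g ⟫, the transposed identity
--   ⟪ k * l , σᵀ n g ⟫ = Σ_{i+j=n} ⟪ σ_i k , u ↦ ⟪ σ_j l , v ↦ ⟪ u * v , g ⟫ ⟫ ⟫
-- by induction on the last entries of k and l. Both operations obey a last-entry recursion:
-- (k,a) * (l,b) is the three-term sum of the definition, and
-- σ_n(k,a) = Σ_{p+m=n} C(a+p-1,p) (σ_m k, a+p). Expanding both sides with these recursions and
-- the induction hypotheses yields three quadruple sums over p+q+p′+q′ = n that agree after
-- reindexing; the term coming from (k * l, a+b) also needs Vandermonde's identity
--   C(a+b+s-1,s) = Σ_{p+p′=s} C(a+p-1,p) C(b+p′-1,p′).

-- Sums over antidiagonals

antidiag : ℕ → (ℕ → ℕ → ℚ) → ℚ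
antidiag zero    f = f 0 0
antidiag (suc n) f = f 0 (suc n) +ℚ antidiag n (λ i j → f (suc i) j)

antidiag-cong-on : ∀ n {f g : ℕ → ℕ → ℚ} → (∀ i j → i + j ≡ n → f i j ≡ g i j) → antidiag n f ≡ antidiag n g
antidiag-cong-on zero    eq = eq 0 0 refl
antidiag-cong-on (suc n) eq = cong₂ _+ℚ_ (eq 0 (suc n) refl) (antidiag-cong-on n (λ i j e → eq (suc i) j (cong suc e)))

antidiag-cong : ∀ n {f g : ℕ → ℕ → ℚ} → (∀ i j → f i j ≡ g i j) → antidiag n f ≡ antidiag n g
antidiag-cong n eq = antidiag-cong-on n (λ i j _ → eq i j)

antidiag-zero : ∀ n {f : ℕ → ℕ → ℚ} → (∀ i j → f i j ≡ 0ℚ) → antidiag n f ≡ 0ℚ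
antidiag-zero zero    eq = eq 0 0
antidiag-zero (suc n) eq = trans (cong₂ _+ℚ_ (eq 0 (suc n)) (antidiag-zero n (λ i → eq (suc i)))) (+-identityʳ 0ℚ)

antidiag-+ : ∀ n (f g : ℕ → ℕ → ℚ) → antidiag n (λ i j → f i j +ℚ g i j) ≡ antidiag n f +ℚ antidiag n g
antidiag-+ zero    f g = refl
antidiag-+ (suc n) f g = trans (cong (f 0 (suc n) +ℚ g 0 (suc n) +ℚ_) (antidiag-+ n _ _))
  (+-interchange (f 0 (suc n)) (g 0 (suc n)) _ _)

antidiag-*ˡ : ∀ n c (f : ℕ → ℕ → ℚ) → antidiag n (λ i j → c *ℚ f i j) ≡ c *ℚ antidiag n f
antidiag-*ˡ zero    c f = refl
antidiag-*ˡ (suc n) c f = trans (cong (c *ℚ f 0 (suc n) +ℚ_) (antidiag-*ˡ n c _))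
  (sym (*-distribˡ-+ c (f 0 (suc n)) _))

antidiag-*ʳ : ∀ n (f : ℕ → ℕ → ℚ) c → antidiag n (λ i j → f i j *ℚ c) ≡ antidiag n f *ℚ c
antidiag-*ʳ n f c = begin
  antidiag n (λ i j → f i j *ℚ c) ≡⟨ antidiag-cong n (λ i j → *-comm (f i j) c) ⟩
  antidiag n (λ i j → c *ℚ f i j) ≡⟨ antidiag-*ˡ n c f ⟩
  c *ℚ antidiag n f               ≡⟨ *-comm c _ ⟩
  antidiag n f *ℚ c               ∎

antidiag-first : ∀ n (f : ℕ → ℕ → ℚ) → (∀ i j → f (suc i) j ≡ 0ℚ) → antidiag n f ≡ f 0 n
antidiag-first zero    f eq = refl
antidiag-first (suc n) f eq = trans (cong (f 0 (suc n) +ℚ_) (antidiag-zero n eq)) (+-identityʳ _)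

antidiag-unfoldʳ : ∀ n (f : ℕ → ℕ → ℚ) → antidiag (suc n) f ≡ antidiag n (λ i j → f i (suc j)) +ℚ f (suc n) 0
antidiag-unfoldʳ zero    f = refl
antidiag-unfoldʳ (suc n) f = trans (cong (f 0 (suc (suc n)) +ℚ_) (antidiag-unfoldʳ n (λ i j → f (suc i) j)))
  (sym (+-assoc (f 0 (suc (suc n))) _ _))

antidiag-comm : ∀ n (f : ℕ → ℕ → ℚ) → antidiag n f ≡ antidiag n (flip f)
antidiag-comm zero    f = refl
antidiag-comm (suc n) f = begin
  f 0 (suc n) +ℚ antidiag n (λ i j → f (suc i) j) ≡⟨ cong (f 0 (suc n) +ℚ_) (antidiag-comm n _) ⟩
  f 0 (suc n) +ℚ antidiag n (λ i j → f (suc j) i) ≡⟨ +-comm (f 0 (suc n)) _ ⟩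
  antidiag n (λ i j → f (suc j) i) +ℚ f 0 (suc n) ≡⟨ sym (antidiag-unfoldʳ n (flip f)) ⟩
  antidiag (suc n) (flip f)                        ∎

antidiag-last : ∀ n (f : ℕ → ℕ → ℚ) → (∀ i j → f i (suc j) ≡ 0ℚ) → antidiag n f ≡ f n 0
antidiag-last n f eq = trans (antidiag-comm n f) (antidiag-first n (flip f) (flip eq))

antidiag-*-antidiag : ∀ s r (f g : ℕ → ℕ → ℚ) →
  antidiag s f *ℚ antidiag r g ≡ antidiag s (λ p p′ → antidiag r (λ q q′ → f p p′ *ℚ g q q′))
antidiag-*-antidiag s r f g = begin
  antidiag s f *ℚ antidiag r g                       ≡⟨ sym (antidiag-*ʳ s f _) ⟩
  antidiag s (λ p p′ → f p p′ *ℚ antidiag r g)       ≡⟨ antidiag-cong s (λ p p′ → sym (antidiag-*ˡ r (f p p′) g)) ⟩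
  antidiag s (λ p p′ → antidiag r (λ q q′ → f p p′ *ℚ g q q′)) ∎

antidiag-assoc : ∀ n (f : ℕ → ℕ → ℕ → ℚ) →
  antidiag n (λ i j → antidiag i (λ p q → f p q j)) ≡ antidiag n (λ p r → antidiag r (λ q j → f p q j))
antidiag-assoc zero    f = refl
antidiag-assoc (suc n) f = begin
  f 0 0 (suc n) +ℚ antidiag n (λ i j → f 0 (suc i) j +ℚ antidiag i (λ p q → f (suc p) q j))
    ≡⟨ cong (f 0 0 (suc n) +ℚ_) (antidiag-+ n _ _) ⟩
  f 0 0 (suc n) +ℚ (column +ℚ antidiag n (λ i j → antidiag i (λ p q → f (suc p) q j)))
    ≡⟨ sym (+-assoc (f 0 0 (suc n)) column _) ⟩
  (f 0 0 (suc n) +ℚ column) +ℚ antidiag n (λ i j → antidiag i (λ p q → f (suc p) q j))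
    ≡⟨ cong ((f 0 0 (suc n) +ℚ column) +ℚ_) (antidiag-assoc n (λ p → f (suc p))) ⟩
  (f 0 0 (suc n) +ℚ column) +ℚ antidiag n (λ p r → antidiag r (λ q j → f (suc p) q j)) ∎
  where
  column : ℚ
  column = antidiag n (λ i j → f 0 (suc i) j)

antidiag-leftComm : ∀ n (f : ℕ → ℕ → ℕ → ℚ) →
  antidiag n (λ i m → antidiag m (λ j k → f i j k)) ≡ antidiag n (λ j m → antidiag m (λ i k → f i j k))
antidiag-leftComm n f = begin
  antidiag n (λ i m → antidiag m (λ j k → f i j k)) ≡⟨ sym (antidiag-assoc n f) ⟩
  antidiag n (λ s k → antidiag s (λ i j → f i j k)) ≡⟨ antidiag-cong n (λ s k → antidiag-comm s (λ i j → f i j k)) ⟩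
  antidiag n (λ s k → antidiag s (λ j i → f i j k)) ≡⟨ antidiag-assoc n (λ j i k → f i j k) ⟩
  antidiag n (λ j m → antidiag m (λ i k → f i j k)) ∎

antidiag-exchange : ∀ s r (f : ℕ → ℕ → ℕ → ℕ → ℚ) →
  antidiag s (λ p q → antidiag r (λ p′ q′ → f p q p′ q′)) ≡
  antidiag r (λ p′ q′ → antidiag s (λ p q → f p q p′ q′))
antidiag-exchange zero    r f = refl
antidiag-exchange (suc s) r f = begin
  antidiag r (f 0 (suc s)) +ℚ antidiag s (λ p q → antidiag r (f (suc p) q))
    ≡⟨ cong (antidiag r (f 0 (suc s)) +ℚ_) (antidiag-exchange s r (λ p → f (suc p))) ⟩
  antidiag r (f 0 (suc s)) +ℚ antidiag r (λ p′ q′ → antidiag s (λ p q → f (suc p) q p′ q′))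
    ≡⟨ sym (antidiag-+ r _ _) ⟩
  antidiag r (λ p′ q′ → antidiag (suc s) (λ p q → f p q p′ q′)) ∎

antidiag-interchange : ∀ n (f : ℕ → ℕ → ℕ → ℕ → ℚ) →
  antidiag n (λ i j → antidiag i (λ p q → antidiag j (λ p′ q′ → f p q p′ q′))) ≡
  antidiag n (λ s r → antidiag s (λ p p′ → antidiag r (λ q q′ → f p q p′ q′)))
antidiag-interchange n f = begin
  antidiag n (λ i j → antidiag i (λ p q → antidiag j (λ p′ q′ → f p q p′ q′)))
    ≡⟨ antidiag-assoc n (λ p q j → antidiag j (f p q)) ⟩
  antidiag n (λ p r → antidiag r (λ q j → antidiag j (λ p′ q′ → f p q p′ q′)))
    ≡⟨ antidiag-cong n (λ p r → antidiag-leftComm r (λ q p′ q′ → f p q p′ q′)) ⟩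
  antidiag n (λ p r → antidiag r (λ p′ m → antidiag m (λ q q′ → f p q p′ q′)))
    ≡⟨ sym (antidiag-assoc n (λ p p′ m → antidiag m (λ q q′ → f p q p′ q′))) ⟩
  antidiag n (λ s r → antidiag s (λ p p′ → antidiag r (λ q q′ → f p q p′ q′))) ∎

-- Multiset coefficients

fromℕℚ≡mkℚ : ∀ m → fromℕℚ m ≡ mkℚ (+ m) 0 (coprime-sym (1-coprimeTo m))
fromℕℚ≡mkℚ m = ℚ.normalize-coprime (coprime-sym (1-coprimeTo m))

fromℕℚ-+ : ∀ m n → fromℕℚ (m + n) ≡ fromℕℚ m +ℚ fromℕℚ n
fromℕℚ-+ m n rewrite fromℕℚ≡mkℚ m | fromℕℚ≡mkℚ n =
  cong (_/ 1) (sym (cong₂ ℤ._+_ (ℤ.*-identityʳ (+ m)) (ℤ.*-identityʳ (+ n))))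

-- With truncated subtraction, multichoose 0 j is 1 for j = 0 and 0 otherwise; this keeps
-- Vandermonde's identity valid at a = 0, so positivity of index entries is never used.
multichoose : ℕ → ℕ → ℚ
multichoose k j = fromℕℚ ((k + j ∸ 1) C j)

multichoose-0-suc : ∀ j → multichoose 0 (suc j) ≡ 0ℚ
multichoose-0-suc j = cong fromℕℚ (k>n⇒nCk≡0 (ℕ.n<1+n j))

multichoose-pascal : ∀ a j → multichoose (suc a) (suc j) ≡ multichoose (suc a) j +ℚ multichoose a (suc j)
multichoose-pascal a j = begin
  fromℕℚ ((a + suc j) C suc j)                      ≡⟨ cong (λ m → fromℕℚ (m C suc j)) (ℕ.+-suc a j) ⟩
  fromℕℚ (suc (a + j) C suc j)                      ≡⟨ cong fromℕℚ (sym (nCk+nC[k+1]≡[n+1]C[k+1] (a + j) j)) ⟩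
  fromℕℚ ((a + j) C j + (a + j) C suc j)            ≡⟨ fromℕℚ-+ ((a + j) C j) _ ⟩
  fromℕℚ ((a + j) C j) +ℚ fromℕℚ ((a + j) C suc j)
    ≡⟨ cong (λ m → fromℕℚ ((a + j) C j) +ℚ fromℕℚ ((m ∸ 1) C suc j)) (sym (ℕ.+-suc a j)) ⟩
  multichoose (suc a) j +ℚ multichoose a (suc j)    ∎

multichoose-suc : ∀ a s → multichoose (suc a) s ≡ antidiag s (λ j _ → multichoose a j)
multichoose-suc a zero    = refl
multichoose-suc a (suc s) = begin
  multichoose (suc a) (suc s)                          ≡⟨ multichoose-pascal a s ⟩
  multichoose (suc a) s +ℚ multichoose a (suc s)       ≡⟨ cong (_+ℚ multichoose a (suc s)) (multichoose-suc a s) ⟩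
  antidiag s (λ j _ → multichoose a j) +ℚ multichoose a (suc s) ≡⟨ sym (antidiag-unfoldʳ s (λ j _ → multichoose a j)) ⟩
  antidiag (suc s) (λ j _ → multichoose a j)           ∎

multichoose-vandermonde : ∀ a b s → multichoose (a + b) s ≡ antidiag s (λ p p′ → multichoose a p *ℚ multichoose b p′)
multichoose-vandermonde zero b s = sym (begin
  antidiag s (λ p p′ → multichoose 0 p *ℚ multichoose b p′)
    ≡⟨ antidiag-first s _ (λ i j → trans (cong (_*ℚ multichoose b j) (multichoose-0-suc i)) (*-zeroˡ (multichoose b j))) ⟩
  1ℚ *ℚ multichoose b s ≡⟨ *-identityˡ _ ⟩
  multichoose b s ∎)
multichoose-vandermonde (suc a) b s = begin
  multichoose (suc (a + b)) s
    ≡⟨ multichoose-suc (a + b) s ⟩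
  antidiag s (λ j _ → multichoose (a + b) j)
    ≡⟨ antidiag-cong s (λ j _ → multichoose-vandermonde a b j) ⟩
  antidiag s (λ j k → antidiag j (λ p p′ → c p p′))
    ≡⟨ antidiag-assoc s (λ p p′ _ → c p p′) ⟩
  antidiag s (λ p r → antidiag r (λ p′ _ → c p p′))
    ≡⟨ antidiag-cong s (λ p r → antidiag-comm r (λ p′ _ → c p p′)) ⟩
  antidiag s (λ p r → antidiag r (λ _ p′ → c p p′))
    ≡⟨ sym (antidiag-assoc s (λ p _ p′ → c p p′)) ⟩
  antidiag s (λ i p′ → antidiag i (λ p _ → c p p′))
    ≡⟨ antidiag-cong s (λ i p′ → antidiag-*ʳ i (λ p _ → multichoose a p) (multichoose b p′)) ⟩
  antidiag s (λ i p′ → antidiag i (λ p _ → multichoose a p) *ℚ multichoose b p′)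
    ≡⟨ sym (antidiag-cong s (λ i p′ → cong (_*ℚ multichoose b p′) (multichoose-suc a i))) ⟩
  antidiag s (λ p p′ → multichoose (suc a) p *ℚ multichoose b p′) ∎
  where
  c : ℕ → ℕ → ℚ
  c p p′ = multichoose a p *ℚ multichoose b p′

-- Pairing linear combinations with test functions

⟪_,_⟫ : LC → (Index → ℚ) → ℚ
⟪ []          , g ⟫ = 0ℚ
⟪ (q , v) ∷ x , g ⟫ = q *ℚ g v +ℚ ⟪ x , g ⟫

δ : Index → Index → ℚ
δ w v with ≡-dec ℕ._≟_ v w
... | yes _ = 1ℚ
... | no  _ = 0ℚ

coeff≡⟪δ⟫ : ∀ x w → coeff x w ≡ ⟪ x , δ w ⟫
coeff≡⟪δ⟫ []            w = refl
coeff≡⟪δ⟫ ((q , v) ∷ x) w with ≡-dec ℕ._≟_ v w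
... | yes _ = cong₂ _+ℚ_ (sym (*-identityʳ q)) (coeff≡⟪δ⟫ x w)
... | no  _ = sym (trans (cong (_+ℚ ⟪ x , δ w ⟫) (*-zeroʳ q)) (trans (+-identityˡ _) (sym (coeff≡⟪δ⟫ x w))))

≈-by-pairing : ∀ {x y} → (∀ g → ⟪ x , g ⟫ ≡ ⟪ y , g ⟫) → x ≈ y
≈-by-pairing {x} {y} eq w = trans (coeff≡⟪δ⟫ x w) (trans (eq (δ w)) (sym (coeff≡⟪δ⟫ y w)))

pair-cong : ∀ x {g h} → (∀ v → g v ≡ h v) → ⟪ x , g ⟫ ≡ ⟪ x , h ⟫
pair-cong []            eq = refl
pair-cong ((q , v) ∷ x) eq = cong₂ (λ a b → q *ℚ a +ℚ b) (eq v) (pair-cong x eq)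

pair-++ : ∀ x y g → ⟪ x ++ y , g ⟫ ≡ ⟪ x , g ⟫ +ℚ ⟪ y , g ⟫
pair-++ []            y g = sym (+-identityˡ _)
pair-++ ((q , v) ∷ x) y g = trans (cong (q *ℚ g v +ℚ_) (pair-++ x y g)) (sym (+-assoc (q *ℚ g v) _ _))

pair-zero : ∀ x → ⟪ x , (λ _ → 0ℚ) ⟫ ≡ 0ℚ
pair-zero []            = refl
pair-zero ((q , v) ∷ x) = trans (cong₂ _+ℚ_ (*-zeroʳ q) (pair-zero x)) (+-identityʳ 0ℚ)

pair-+ : ∀ x g h → ⟪ x , (λ v → g v +ℚ h v) ⟫ ≡ ⟪ x , g ⟫ +ℚ ⟪ x , h ⟫
pair-+ []            g h = sym (+-identityˡ _)
pair-+ ((q , v) ∷ x) g h = trans (cong₂ _+ℚ_ (*-distribˡ-+ q (g v) (h v)) (pair-+ x g h))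
  (+-interchange (q *ℚ g v) (q *ℚ h v) _ _)

pair-*ˡ : ∀ x c g → ⟪ x , (λ v → c *ℚ g v) ⟫ ≡ c *ℚ ⟪ x , g ⟫
pair-*ˡ []            c g = sym (*-zeroʳ c)
pair-*ˡ ((q , v) ∷ x) c g = trans (cong₂ _+ℚ_ (*-leftComm q c (g v)) (pair-*ˡ x c g))
  (sym (*-distribˡ-+ c (q *ℚ g v) _))

pair-antidiag : ∀ x n (c : ℕ → ℕ → ℚ) (f : ℕ → ℕ → Index → ℚ) →
  ⟪ x , (λ v → antidiag n (λ i j → c i j *ℚ f i j v)) ⟫ ≡ antidiag n (λ i j → c i j *ℚ ⟪ x , f i j ⟫)
pair-antidiag x zero    c f = pair-*ˡ x (c 0 0) (f 0 0)
pair-antidiag x (suc n) c f = trans (pair-+ x _ _)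
  (cong₂ _+ℚ_ (pair-*ˡ x (c 0 (suc n)) (f 0 (suc n))) (pair-antidiag x n (λ i → c (suc i)) (λ i → f (suc i))))

pair-basis : ∀ k g → ⟪ basis k , g ⟫ ≡ g k
pair-basis k g = trans (+-identityʳ _) (*-identityˡ (g k))

pair-scale : ∀ c x g → ⟪ scale c x , g ⟫ ≡ c *ℚ ⟪ x , g ⟫
pair-scale c []            g = sym (*-zeroʳ c)
pair-scale c ((q , v) ∷ x) g = trans (cong₂ _+ℚ_ (*-assoc c q (g v)) (pair-scale c x g))
  (sym (*-distribˡ-+ c (q *ℚ g v) _))

mapIndices : (Index → Index) → LC → LC
mapIndices f = map (λ e → (proj₁ e , f (proj₂ e)))

pair-mapIndices : ∀ f x g → ⟪ mapIndices f x , g ⟫ ≡ ⟪ x , g ∘ f ⟫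
pair-mapIndices f []            g = refl
pair-mapIndices f ((q , v) ∷ x) g = cong (q *ℚ g (f v) +ℚ_) (pair-mapIndices f x g)

pair-concatMap : ∀ (F : ℚ × Index → LC) (h : Index → ℚ) x g → (∀ q v → ⟪ F (q , v) , g ⟫ ≡ q *ℚ h v) →
  ⟪ concatMap F x , g ⟫ ≡ ⟪ x , h ⟫
pair-concatMap F h []            g eq = refl
pair-concatMap F h ((q , v) ∷ x) g eq = trans (pair-++ (F (q , v)) (concatMap F x) g)
  (cong₂ _+ℚ_ (eq q v) (pair-concatMap F h x g eq))

pair-concatMap-applyUpTo : ∀ n (f : ℕ → ℕ) (F : ℕ → LC) g →
  ⟪ concatMap F (applyUpTo f (suc n)) , g ⟫ ≡ antidiag n (λ i _ → ⟪ F (f i) , g ⟫)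
pair-concatMap-applyUpTo zero    f F g = trans (pair-++ (F (f 0)) [] g) (+-identityʳ _)
pair-concatMap-applyUpTo (suc n) f F g = trans (pair-++ (F (f 0)) _ g)
  (cong (⟪ F (f 0) , g ⟫ +ℚ_) (pair-concatMap-applyUpTo n (f ∘ suc) F g))

pair-sumLC : ∀ n (F : ℕ → ℕ → LC) g →
  ⟪ sumLC n (λ i → F i (n ∸ i)) , g ⟫ ≡ antidiag n (λ i j → ⟪ F i j , g ⟫)
pair-sumLC n F g = trans (pair-concatMap-applyUpTo n id (λ i → F i (n ∸ i)) g)
  (antidiag-cong-on n (λ i j i+j≡n → cong (λ m → ⟪ F i m , g ⟫)
    (trans (cong (_∸ i) (sym i+j≡n)) (ℕ.m+n∸m≡n i j))))

-- Transposes of σ and of the harmonic product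

σᵀ : ℕ → (Index → ℚ) → Index → ℚ
σᵀ n g w = ⟪ σIdx n w , g ⟫

harmᵀ : (Index → ℚ) → Index → Index → ℚ
harmᵀ g u v = ⟪ harmIdx u v , g ⟫

pair-σ : ∀ n x g → ⟪ σ n x , g ⟫ ≡ ⟪ x , σᵀ n g ⟫
pair-σ n x g = pair-concatMap _ (σᵀ n g) x g (λ q v → pair-scale q (σIdx n v) g)

pair-* : ∀ x y g → ⟪ x * y , g ⟫ ≡ ⟪ x , (λ u → ⟪ y , harmᵀ g u ⟫) ⟫
pair-* x y g = pair-concatMap _ _ x g (λ p u →
  trans (pair-concatMap _ (λ v → p *ℚ harmᵀ g u v) y g (λ q v →
           trans (pair-scale (p *ℚ q) (harmIdx u v) g) (trans (*-assoc p q _) (*-leftComm p q _))))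
        (pair-*ˡ y p (harmᵀ g u)))

pair-σ-basis : ∀ n k g → ⟪ σ n (basis k) , g ⟫ ≡ ⟪ σIdx n k , g ⟫
pair-σ-basis n k g = trans (pair-σ n (basis k) g) (pair-basis k (σᵀ n g))

pair-basis-*-basis : ∀ k l g → ⟪ basis k * basis l , g ⟫ ≡ ⟪ harmIdx k l , g ⟫
pair-basis-*-basis k l g = trans (pair-* (basis k) (basis l) g)
  (trans (pair-basis k (λ u → ⟪ basis l , harmᵀ g u ⟫)) (pair-basis l (harmᵀ g k)))

pair-σ-basis-*-σ-basis : ∀ i j k l g →
  ⟪ σ i (basis k) * σ j (basis l) , g ⟫ ≡ ⟪ σIdx i k , (λ u → ⟪ σIdx j l , harmᵀ g u ⟫) ⟫
pair-σ-basis-*-σ-basis i j k l g = trans (pair-* (σ i (basis k)) (σ j (basis l)) g)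
  (trans (pair-σ-basis i k (λ u → ⟪ σ j (basis l) , harmᵀ g u ⟫))
         (pair-cong (σIdx i k) (λ u → pair-σ-basis j l (harmᵀ g u))))

-- σ and the harmonic product entry by entry

σIdx-∷ : ∀ n a k →
  σIdx n (a ∷ k) ≡ sumLC n (λ j → scale (multichoose a j) (mapIndices ((a + j) ∷_) (σIdx (n ∸ j) k)))
σIdx-∷ zero    a k = refl
σIdx-∷ (suc n) a k = refl

pair-σIdx-∷ : ∀ n a k g →
  ⟪ σIdx n (a ∷ k) , g ⟫ ≡ antidiag n (λ j m → multichoose a j *ℚ ⟪ σIdx m k , g ∘ ((a + j) ∷_) ⟫)
pair-σIdx-∷ n a k g = begin
  ⟪ σIdx n (a ∷ k) , g ⟫
    ≡⟨ cong ⟪_, g ⟫ (σIdx-∷ n a k) ⟩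
  ⟪ sumLC n (λ j → scale (multichoose a j) (mapIndices ((a + j) ∷_) (σIdx (n ∸ j) k))) , g ⟫
    ≡⟨ pair-sumLC n (λ j m → scale (multichoose a j) (mapIndices ((a + j) ∷_) (σIdx m k))) g ⟩
  antidiag n (λ j m → ⟪ scale (multichoose a j) (mapIndices ((a + j) ∷_) (σIdx m k)) , g ⟫)
    ≡⟨ antidiag-cong n (λ j m → trans (pair-scale (multichoose a j) (mapIndices ((a + j) ∷_) (σIdx m k)) g)
                                       (cong (multichoose a j *ℚ_) (pair-mapIndices ((a + j) ∷_) (σIdx m k) g))) ⟩
  antidiag n (λ j m → multichoose a j *ℚ ⟪ σIdx m k , g ∘ ((a + j) ∷_) ⟫) ∎

pair-σIdx-[]-cong : ∀ m {g h : Index → ℚ} → g [] ≡ h [] → ⟪ σIdx m [] , g ⟫ ≡ ⟪ σIdx m [] , h ⟫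
pair-σIdx-[]-cong zero    eq = cong (λ z → 1ℚ *ℚ z +ℚ 0ℚ) eq
pair-σIdx-[]-cong (suc m) eq = refl

pair-σIdx-∷ʳ : ∀ n k a g →
  ⟪ σIdx n (k ∷ʳ a) , g ⟫ ≡ antidiag n (λ j m → multichoose a j *ℚ ⟪ σIdx m k , g ∘ (_∷ʳ (a + j)) ⟫)
pair-σIdx-∷ʳ n []      a g = trans (pair-σIdx-∷ n a [] g)
  (antidiag-cong n (λ j m → cong (multichoose a j *ℚ_) (pair-σIdx-[]-cong m refl)))
pair-σIdx-∷ʳ n (b ∷ k) a g = begin
  ⟪ σIdx n (b ∷ (k ∷ʳ a)) , g ⟫
    ≡⟨ pair-σIdx-∷ n b (k ∷ʳ a) g ⟩
  antidiag n (λ j m → multichoose b j *ℚ ⟪ σIdx m (k ∷ʳ a) , g ∘ ((b + j) ∷_) ⟫)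
    ≡⟨ antidiag-cong n (λ j m → cong (multichoose b j *ℚ_) (pair-σIdx-∷ʳ m k a (g ∘ ((b + j) ∷_)))) ⟩
  antidiag n (λ j m → multichoose b j *ℚ antidiag m (λ j′ m′ → multichoose a j′ *ℚ w j j′ m′))
    ≡⟨ antidiag-cong n (λ j m → trans (sym (antidiag-*ˡ m (multichoose b j) _))
                                       (antidiag-cong m (λ j′ m′ → *-leftComm (multichoose b j) (multichoose a j′) _))) ⟩
  antidiag n (λ j m → antidiag m (λ j′ m′ → multichoose a j′ *ℚ (multichoose b j *ℚ w j j′ m′)))
    ≡⟨ antidiag-leftComm n (λ j j′ m′ → multichoose a j′ *ℚ (multichoose b j *ℚ w j j′ m′)) ⟩
  antidiag n (λ j′ m → antidiag m (λ j m′ → multichoose a j′ *ℚ (multichoose b j *ℚ w j j′ m′)))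
    ≡⟨ antidiag-cong n (λ j′ m → antidiag-*ˡ m (multichoose a j′) _) ⟩
  antidiag n (λ j′ m → multichoose a j′ *ℚ antidiag m (λ j m′ → multichoose b j *ℚ w j j′ m′))
    ≡⟨ sym (antidiag-cong n (λ j′ m → cong (multichoose a j′ *ℚ_) (pair-σIdx-∷ m b k (g ∘ (_∷ʳ (a + j′)))))) ⟩
  antidiag n (λ j′ m → multichoose a j′ *ℚ ⟪ σIdx m (b ∷ k) , g ∘ (_∷ʳ (a + j′)) ⟫) ∎
  where
  w : ℕ → ℕ → ℕ → ℚ
  w j j′ m′ = ⟪ σIdx m′ k , (λ u → g ((b + j) ∷ (u ∷ʳ (a + j′)))) ⟫

pair-pair-σIdx-∷ʳ : ∀ x n c (W : Index → Index) (F : Index → Index → ℚ) →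
  ⟪ x , (λ u → ⟪ σIdx n (W u ∷ʳ c) , F u ⟫) ⟫ ≡
  antidiag n (λ s r → multichoose c s *ℚ ⟪ x , (λ u → ⟪ σIdx r (W u) , F u ∘ (_∷ʳ (c + s)) ⟫) ⟫)
pair-pair-σIdx-∷ʳ x n c W F = trans (pair-cong x (λ u → pair-σIdx-∷ʳ n (W u) c (F u)))
  (pair-antidiag x n (λ s _ → multichoose c s) (λ s r u → ⟪ σIdx r (W u) , F u ∘ (_∷ʳ (c + s)) ⟫))

mapIndices-reverse-∷ : ∀ a x → mapIndices reverse (mapIndices (a ∷_) x) ≡ mapIndices (_∷ʳ a) (mapIndices reverse x)
mapIndices-reverse-∷ a []            = refl
mapIndices-reverse-∷ a ((q , v) ∷ x) = cong₂ _∷_ (cong (q ,_) (unfold-reverse a v)) (mapIndices-reverse-∷ a x)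

mapIndices-reverse-∷₃ : ∀ a b c {x y z x′ y′ z′} →
  mapIndices reverse x ≡ x′ → mapIndices reverse y ≡ y′ → mapIndices reverse z ≡ z′ →
  mapIndices reverse (mapIndices (a ∷_) x ++ (mapIndices (b ∷_) y ++ mapIndices (c ∷_) z)) ≡
  mapIndices (_∷ʳ a) x′ ++ (mapIndices (_∷ʳ b) y′ ++ mapIndices (_∷ʳ c) z′)
mapIndices-reverse-∷₃ a b c {x} {y} {z} refl refl refl = begin
  mapIndices reverse (mapIndices (a ∷_) x ++ (mapIndices (b ∷_) y ++ mapIndices (c ∷_) z))
    ≡⟨ map-++ _ (mapIndices (a ∷_) x) _ ⟩
  mapIndices reverse (mapIndices (a ∷_) x) ++ mapIndices reverse (mapIndices (b ∷_) y ++ mapIndices (c ∷_) z)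
    ≡⟨ cong₂ _++_ (mapIndices-reverse-∷ a x) (map-++ _ (mapIndices (b ∷_) y) _) ⟩
  mapIndices (_∷ʳ a) (mapIndices reverse x) ++
    (mapIndices reverse (mapIndices (b ∷_) y) ++ mapIndices reverse (mapIndices (c ∷_) z))
    ≡⟨ cong (mapIndices (_∷ʳ a) (mapIndices reverse x) ++_)
            (cong₂ _++_ (mapIndices-reverse-∷ b y) (mapIndices-reverse-∷ c z)) ⟩
  mapIndices (_∷ʳ a) (mapIndices reverse x) ++
    (mapIndices (_∷ʳ b) (mapIndices reverse y) ++ mapIndices (_∷ʳ c) (mapIndices reverse z)) ∎

harmIdx-[]ˡ : ∀ l → harmIdx [] l ≡ basis l
harmIdx-[]ˡ l = cong (λ v → [ (1ℚ , v) ]) (reverse-involutive l)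

harmIdx-[]ʳ : ∀ k → harmIdx k [] ≡ basis k
harmIdx-[]ʳ k with reverse k | reverse-selfInverse {x = k} refl
... | []    | eq = cong (λ v → [ (1ℚ , v) ]) eq
... | _ ∷ _ | eq = cong (λ v → [ (1ℚ , v) ]) eq

harmIdx-∷ʳ : ∀ k l a b → harmIdx (k ∷ʳ a) (l ∷ʳ b) ≡
  mapIndices (_∷ʳ a) (harmIdx k (l ∷ʳ b)) ++
    (mapIndices (_∷ʳ b) (harmIdx (k ∷ʳ a) l) ++ mapIndices (_∷ʳ (a + b)) (harmIdx k l))
-- `harmIdx` recurses through a private function on reversed indices. After the rewrite the goal
-- contains recursive calls of that function, which cannot be named here; the trivial equations
-- are rewritten along with the goal and pass those calls on to `mapIndices-reverse-∷₃`.
harmIdx-∷ʳ k l a b = unfolded refl refl refl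
  where
  unfolded : harmIdx k (l ∷ʳ b) ≡ harmIdx k (l ∷ʳ b) → harmIdx (k ∷ʳ a) l ≡ harmIdx (k ∷ʳ a) l →
    harmIdx k l ≡ harmIdx k l → harmIdx (k ∷ʳ a) (l ∷ʳ b) ≡
    mapIndices (_∷ʳ a) (harmIdx k (l ∷ʳ b)) ++
      (mapIndices (_∷ʳ b) (harmIdx (k ∷ʳ a) l) ++ mapIndices (_∷ʳ (a + b)) (harmIdx k l))
  unfolded rewrite reverse-++ k [ a ] | reverse-++ l [ b ] = mapIndices-reverse-∷₃ a b (a + b)

pair-harmIdx-[]ˡ : ∀ l g → ⟪ harmIdx [] l , g ⟫ ≡ g l
pair-harmIdx-[]ˡ l g = trans (cong ⟪_, g ⟫ (harmIdx-[]ˡ l)) (pair-basis l g)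

pair-harmIdx-[]ʳ : ∀ k g → ⟪ harmIdx k [] , g ⟫ ≡ g k
pair-harmIdx-[]ʳ k g = trans (cong ⟪_, g ⟫ (harmIdx-[]ʳ k)) (pair-basis k g)

pair-harmIdx-∷ʳ : ∀ k l a b g → ⟪ harmIdx (k ∷ʳ a) (l ∷ʳ b) , g ⟫ ≡
  ⟪ harmIdx k (l ∷ʳ b) , g ∘ (_∷ʳ a) ⟫ +ℚ
    (⟪ harmIdx (k ∷ʳ a) l , g ∘ (_∷ʳ b) ⟫ +ℚ ⟪ harmIdx k l , g ∘ (_∷ʳ (a + b)) ⟫)
pair-harmIdx-∷ʳ k l a b g = begin
  ⟪ harmIdx (k ∷ʳ a) (l ∷ʳ b) , g ⟫
    ≡⟨ cong ⟪_, g ⟫ (harmIdx-∷ʳ k l a b) ⟩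
  ⟪ x ++ (y ++ z) , g ⟫
    ≡⟨ trans (pair-++ x (y ++ z) g) (cong (⟪ x , g ⟫ +ℚ_) (pair-++ y z g)) ⟩
  ⟪ x , g ⟫ +ℚ (⟪ y , g ⟫ +ℚ ⟪ z , g ⟫)
    ≡⟨ cong₂ _+ℚ_ (pair-mapIndices (_∷ʳ a) (harmIdx k (l ∷ʳ b)) g)
         (cong₂ _+ℚ_ (pair-mapIndices (_∷ʳ b) (harmIdx (k ∷ʳ a) l) g)
                     (pair-mapIndices (_∷ʳ (a + b)) (harmIdx k l) g)) ⟩
  ⟪ harmIdx k (l ∷ʳ b) , g ∘ (_∷ʳ a) ⟫ +ℚ
    (⟪ harmIdx (k ∷ʳ a) l , g ∘ (_∷ʳ b) ⟫ +ℚ ⟪ harmIdx k l , g ∘ (_∷ʳ (a + b)) ⟫) ∎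
  where
  x y z : LC
  x = mapIndices (_∷ʳ a) (harmIdx k (l ∷ʳ b))
  y = mapIndices (_∷ʳ b) (harmIdx (k ∷ʳ a) l)
  z = mapIndices (_∷ʳ (a + b)) (harmIdx k l)

-- The transposed Leibniz rule

Leibniz : Index → Index → Set
Leibniz k l = ∀ n g →
  ⟪ harmIdx k l , σᵀ n g ⟫ ≡ antidiag n (λ i j → ⟪ σIdx i k , (λ u → ⟪ σIdx j l , harmᵀ g u ⟫) ⟫)

leibniz-[]ˡ : ∀ l → Leibniz [] l
leibniz-[]ˡ l n g = begin
  ⟪ harmIdx [] l , σᵀ n g ⟫
    ≡⟨ pair-harmIdx-[]ˡ l (σᵀ n g) ⟩
  ⟪ σIdx n l , g ⟫
    ≡⟨ pair-cong (σIdx n l) (λ v → sym (pair-harmIdx-[]ˡ v g)) ⟩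
  ⟪ σIdx n l , harmᵀ g [] ⟫
    ≡⟨ sym (pair-basis [] (λ u → ⟪ σIdx n l , harmᵀ g u ⟫)) ⟩
  ⟪ σIdx 0 [] , (λ u → ⟪ σIdx n l , harmᵀ g u ⟫) ⟫
    ≡⟨ sym (antidiag-first n _ (λ i j → refl)) ⟩
  antidiag n (λ i j → ⟪ σIdx i [] , (λ u → ⟪ σIdx j l , harmᵀ g u ⟫) ⟫) ∎

leibniz-[]ʳ : ∀ k → Leibniz k []
leibniz-[]ʳ k n g = begin
  ⟪ harmIdx k [] , σᵀ n g ⟫
    ≡⟨ pair-harmIdx-[]ʳ k (σᵀ n g) ⟩
  ⟪ σIdx n k , g ⟫
    ≡⟨ pair-cong (σIdx n k) (λ u → sym (pair-harmIdx-[]ʳ u g)) ⟩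
  ⟪ σIdx n k , (λ u → harmᵀ g u []) ⟫
    ≡⟨ pair-cong (σIdx n k) (λ u → sym (pair-basis [] (harmᵀ g u))) ⟩
  ⟪ σIdx n k , (λ u → ⟪ σIdx 0 [] , harmᵀ g u ⟫) ⟫
    ≡⟨ sym (antidiag-last n _ (λ i j → pair-zero (σIdx i k))) ⟩
  antidiag n (λ i j → ⟪ σIdx i k , (λ u → ⟪ σIdx j [] , harmᵀ g u ⟫) ⟫) ∎

module Leibniz-step {k l : Index} (a b : ℕ)
                    (ih₁ : Leibniz k (l ∷ʳ b)) (ih₂ : Leibniz (k ∷ʳ a) l) (ih₃ : Leibniz k l)
                    (n : ℕ) (g : Index → ℚ) where

  summand : (ℕ → ℕ → Index → Index → ℚ) → ℕ → ℕ → ℕ → ℕ → ℚ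
  summand X p q p′ q′ =
    multichoose a p *ℚ (multichoose b p′ *ℚ ⟪ σIdx q k , (λ u → ⟪ σIdx q′ l , X p p′ u ⟫) ⟫)

  summand-+ : ∀ X Y p q p′ q′ →
    summand (λ p p′ u v → X p p′ u v +ℚ Y p p′ u v) p q p′ q′ ≡ summand X p q p′ q′ +ℚ summand Y p q p′ q′
  summand-+ X Y p q p′ q′ = begin
    multichoose a p *ℚ (multichoose b p′ *ℚ ⟪ σIdx q k , (λ u → ⟪ σIdx q′ l , (λ v → X p p′ u v +ℚ Y p p′ u v) ⟫) ⟫)
      ≡⟨ cong (λ t → multichoose a p *ℚ (multichoose b p′ *ℚ t))
              (trans (pair-cong (σIdx q k) (λ u → pair-+ (σIdx q′ l) (X p p′ u) (Y p p′ u)))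
                     (pair-+ (σIdx q k) x y)) ⟩
    multichoose a p *ℚ (multichoose b p′ *ℚ (⟪ σIdx q k , x ⟫ +ℚ ⟪ σIdx q k , y ⟫))
      ≡⟨ trans (cong (multichoose a p *ℚ_) (*-distribˡ-+ (multichoose b p′) _ _))
               (*-distribˡ-+ (multichoose a p) _ _) ⟩
    summand X p q p′ q′ +ℚ summand Y p q p′ q′ ∎
    where
    x y : Index → ℚ
    x u = ⟪ σIdx q′ l , X p p′ u ⟫
    y u = ⟪ σIdx q′ l , Y p p′ u ⟫

  total : (ℕ → ℕ → ℕ → ℕ → ℚ) → ℚ
  total T = antidiag n (λ i j → antidiag i (λ p q → antidiag j (λ p′ q′ → T p q p′ q′)))

  total-+ : ∀ T U → total (λ p q p′ q′ → T p q p′ q′ +ℚ U p q p′ q′) ≡ total T +ℚ total U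
  total-+ T U = trans
    (antidiag-cong n (λ i j → trans (antidiag-cong i (λ p q → antidiag-+ j (T p q) (U p q))) (antidiag-+ i _ _)))
    (antidiag-+ n _ _)

  -- The three terms of the harmonic recursion for (u, a + p) * (v, b + p′), paired with g.
  X₁ X₂ X₃ : ℕ → ℕ → Index → Index → ℚ
  X₁ p p′ u v = harmᵀ (g ∘ (_∷ʳ (a + p))) u (v ∷ʳ (b + p′))
  X₂ p p′ u v = harmᵀ (g ∘ (_∷ʳ (b + p′))) (u ∷ʳ (a + p)) v
  X₃ p p′ u v = harmᵀ (g ∘ (_∷ʳ ((a + p) + (b + p′)))) u v

  left₁ : ⟪ harmIdx k (l ∷ʳ b) , σᵀ n g ∘ (_∷ʳ a) ⟫ ≡ total (summand X₁)
  left₁ = begin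
    ⟪ harmIdx k (l ∷ʳ b) , σᵀ n g ∘ (_∷ʳ a) ⟫
      ≡⟨ pair-pair-σIdx-∷ʳ (harmIdx k (l ∷ʳ b)) n a id (λ _ → g) ⟩
    antidiag n (λ p r → multichoose a p *ℚ ⟪ harmIdx k (l ∷ʳ b) , σᵀ r (g ∘ (_∷ʳ (a + p))) ⟫)
      ≡⟨ antidiag-cong n (λ p r → cong (multichoose a p *ℚ_) (ih₁ r (g ∘ (_∷ʳ (a + p))))) ⟩
    antidiag n (λ p r → multichoose a p *ℚ
      antidiag r (λ q j → ⟪ σIdx q k , (λ u → ⟪ σIdx j (l ∷ʳ b) , harmᵀ (g ∘ (_∷ʳ (a + p))) u ⟫) ⟫))
      ≡⟨ antidiag-cong n (λ p r → cong (multichoose a p *ℚ_) (antidiag-cong r (λ q j →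
           pair-pair-σIdx-∷ʳ (σIdx q k) j b (λ _ → l) (harmᵀ (g ∘ (_∷ʳ (a + p))))))) ⟩
    antidiag n (λ p r → multichoose a p *ℚ
      antidiag r (λ q j → antidiag j (λ p′ q′ →
        multichoose b p′ *ℚ ⟪ σIdx q k , (λ u → ⟪ σIdx q′ l , X₁ p p′ u ⟫) ⟫)))
      ≡⟨ antidiag-cong n (λ p r → trans (sym (antidiag-*ˡ r (multichoose a p) _))
           (antidiag-cong r (λ q j → sym (antidiag-*ˡ j (multichoose a p) _)))) ⟩
    antidiag n (λ p r → antidiag r (λ q j → antidiag j (λ p′ q′ → summand X₁ p q p′ q′)))
      ≡⟨ sym (antidiag-assoc n (λ p q j → antidiag j (summand X₁ p q))) ⟩
    total (summand X₁) ∎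

  left₂ : ⟪ harmIdx (k ∷ʳ a) l , σᵀ n g ∘ (_∷ʳ b) ⟫ ≡ total (summand X₂)
  left₂ = begin
    ⟪ harmIdx (k ∷ʳ a) l , σᵀ n g ∘ (_∷ʳ b) ⟫
      ≡⟨ pair-pair-σIdx-∷ʳ (harmIdx (k ∷ʳ a) l) n b id (λ _ → g) ⟩
    antidiag n (λ p′ r → multichoose b p′ *ℚ ⟪ harmIdx (k ∷ʳ a) l , σᵀ r (g ∘ (_∷ʳ (b + p′))) ⟫)
      ≡⟨ antidiag-cong n (λ p′ r → cong (multichoose b p′ *ℚ_) (ih₂ r (g ∘ (_∷ʳ (b + p′))))) ⟩
    antidiag n (λ p′ r → multichoose b p′ *ℚ
      antidiag r (λ i q′ → ⟪ σIdx i (k ∷ʳ a) , (λ u → ⟪ σIdx q′ l , harmᵀ (g ∘ (_∷ʳ (b + p′))) u ⟫) ⟫))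
      ≡⟨ antidiag-cong n (λ p′ r → cong (multichoose b p′ *ℚ_) (antidiag-cong r (λ i q′ →
           pair-σIdx-∷ʳ i k a (λ u → ⟪ σIdx q′ l , harmᵀ (g ∘ (_∷ʳ (b + p′))) u ⟫)))) ⟩
    antidiag n (λ p′ r → multichoose b p′ *ℚ
      antidiag r (λ i q′ → antidiag i (λ p q →
        multichoose a p *ℚ ⟪ σIdx q k , (λ u → ⟪ σIdx q′ l , X₂ p p′ u ⟫) ⟫)))
      ≡⟨ antidiag-cong n (λ p′ r → trans (sym (antidiag-*ˡ r (multichoose b p′) _))
           (antidiag-cong r (λ i q′ → trans (sym (antidiag-*ˡ i (multichoose b p′) _))
             (antidiag-cong i (λ p q → *-leftComm (multichoose b p′) (multichoose a p) _))))) ⟩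
    antidiag n (λ p′ r → antidiag r (λ i q′ → antidiag i (λ p q → summand X₂ p q p′ q′)))
      ≡⟨ sym (antidiag-leftComm n (λ i p′ q′ → antidiag i (λ p q → summand X₂ p q p′ q′))) ⟩
    antidiag n (λ i j → antidiag j (λ p′ q′ → antidiag i (λ p q → summand X₂ p q p′ q′)))
      ≡⟨ antidiag-cong n (λ i j → sym (antidiag-exchange i j (summand X₂))) ⟩
    total (summand X₂) ∎

  left₃ : ⟪ harmIdx k l , σᵀ n g ∘ (_∷ʳ (a + b)) ⟫ ≡ total (summand X₃)
  left₃ = begin
    ⟪ harmIdx k l , σᵀ n g ∘ (_∷ʳ (a + b)) ⟫
      ≡⟨ pair-pair-σIdx-∷ʳ (harmIdx k l) n (a + b) id (λ _ → g) ⟩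
    antidiag n (λ s r → multichoose (a + b) s *ℚ ⟪ harmIdx k l , σᵀ r (g ∘ (_∷ʳ (a + b + s))) ⟫)
      ≡⟨ antidiag-cong n (λ s r → cong₂ _*ℚ_ (multichoose-vandermonde a b s) (ih₃ r (g ∘ (_∷ʳ (a + b + s))))) ⟩
    antidiag n (λ s r → antidiag s (λ p p′ → multichoose a p *ℚ multichoose b p′) *ℚ antidiag r (y s))
      ≡⟨ antidiag-cong n (λ s r → antidiag-*-antidiag s r _ (y s)) ⟩
    antidiag n (λ s r → antidiag s (λ p p′ → antidiag r (λ q q′ →
      (multichoose a p *ℚ multichoose b p′) *ℚ y s q q′)))
      ≡⟨ antidiag-cong n (λ s r → antidiag-cong-on s (λ p p′ p+p′≡s → antidiag-cong r (λ q q′ →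
           trans (*-assoc (multichoose a p) (multichoose b p′) _)
             (cong (λ m → multichoose a p *ℚ (multichoose b p′ *ℚ z m q q′))
                   (trans (cong (λ m → a + b + m) (sym p+p′≡s)) (ℕ-+-interchange a b p p′)))))) ⟩
    antidiag n (λ s r → antidiag s (λ p p′ → antidiag r (λ q q′ → summand X₃ p q p′ q′)))
      ≡⟨ sym (antidiag-interchange n (summand X₃)) ⟩
    total (summand X₃) ∎
    where
    z : ℕ → ℕ → ℕ → ℚ
    z m q q′ = ⟪ σIdx q k , (λ u → ⟪ σIdx q′ l , harmᵀ (g ∘ (_∷ʳ m)) u ⟫) ⟫
    y : ℕ → ℕ → ℕ → ℚ
    y s = z (a + b + s)

  summand₁₂₃ : ℕ → ℕ → ℕ → ℕ → ℚ
  summand₁₂₃ p q p′ q′ = summand X₁ p q p′ q′ +ℚ (summand X₂ p q p′ q′ +ℚ summand X₃ p q p′ q′)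

  right : antidiag n (λ i j → ⟪ σIdx i (k ∷ʳ a) , (λ u → ⟪ σIdx j (l ∷ʳ b) , harmᵀ g u ⟫) ⟫) ≡
          total (summand X₁) +ℚ (total (summand X₂) +ℚ total (summand X₃))
  right = begin
    antidiag n (λ i j → ⟪ σIdx i (k ∷ʳ a) , (λ u → ⟪ σIdx j (l ∷ʳ b) , harmᵀ g u ⟫) ⟫)
      ≡⟨ antidiag-cong n expand ⟩
    total summand₁₂₃
      ≡⟨ trans (total-+ (summand X₁) _) (cong (total (summand X₁) +ℚ_) (total-+ (summand X₂) (summand X₃))) ⟩
    total (summand X₁) +ℚ (total (summand X₂) +ℚ total (summand X₃)) ∎
    where
    X : ℕ → ℕ → Index → Index → ℚ
    X p p′ u v = harmᵀ g (u ∷ʳ (a + p)) (v ∷ʳ (b + p′))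
    split : ∀ p q p′ q′ → summand X p q p′ q′ ≡ summand₁₂₃ p q p′ q′
    split p q p′ q′ = begin
      summand X p q p′ q′
        ≡⟨ cong (λ t → multichoose a p *ℚ (multichoose b p′ *ℚ t)) (pair-cong (σIdx q k) (λ u →
             pair-cong (σIdx q′ l) (λ v → pair-harmIdx-∷ʳ u v (a + p) (b + p′) g))) ⟩
      summand (λ p p′ u v → X₁ p p′ u v +ℚ (X₂ p p′ u v +ℚ X₃ p p′ u v)) p q p′ q′
        ≡⟨ summand-+ X₁ (λ p p′ u v → X₂ p p′ u v +ℚ X₃ p p′ u v) p q p′ q′ ⟩
      summand X₁ p q p′ q′ +ℚ summand (λ p p′ u v → X₂ p p′ u v +ℚ X₃ p p′ u v) p q p′ q′
        ≡⟨ cong (summand X₁ p q p′ q′ +ℚ_) (summand-+ X₂ X₃ p q p′ q′) ⟩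
      summand₁₂₃ p q p′ q′ ∎
    expand : ∀ i j → ⟪ σIdx i (k ∷ʳ a) , (λ u → ⟪ σIdx j (l ∷ʳ b) , harmᵀ g u ⟫) ⟫ ≡
      antidiag i (λ p q → antidiag j (summand₁₂₃ p q))
    expand i j = begin
      ⟪ σIdx i (k ∷ʳ a) , (λ u → ⟪ σIdx j (l ∷ʳ b) , harmᵀ g u ⟫) ⟫
        ≡⟨ pair-σIdx-∷ʳ i k a (λ u → ⟪ σIdx j (l ∷ʳ b) , harmᵀ g u ⟫) ⟩
      antidiag i (λ p q → multichoose a p *ℚ
        ⟪ σIdx q k , (λ u → ⟪ σIdx j (l ∷ʳ b) , harmᵀ g (u ∷ʳ (a + p)) ⟫) ⟫)
        ≡⟨ antidiag-cong i (λ p q → cong (multichoose a p *ℚ_)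
             (pair-pair-σIdx-∷ʳ (σIdx q k) j b (λ _ → l) (λ u → harmᵀ g (u ∷ʳ (a + p))))) ⟩
      antidiag i (λ p q → multichoose a p *ℚ
        antidiag j (λ p′ q′ → multichoose b p′ *ℚ ⟪ σIdx q k , (λ u → ⟪ σIdx q′ l , X p p′ u ⟫) ⟫))
        ≡⟨ antidiag-cong i (λ p q → trans (sym (antidiag-*ˡ j (multichoose a p) _))
             (antidiag-cong j (split p q))) ⟩
      antidiag i (λ p q → antidiag j (summand₁₂₃ p q)) ∎

  leibniz : ⟪ harmIdx (k ∷ʳ a) (l ∷ʳ b) , σᵀ n g ⟫ ≡
            antidiag n (λ i j → ⟪ σIdx i (k ∷ʳ a) , (λ u → ⟪ σIdx j (l ∷ʳ b) , harmᵀ g u ⟫) ⟫)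
  leibniz = begin
    ⟪ harmIdx (k ∷ʳ a) (l ∷ʳ b) , σᵀ n g ⟫
      ≡⟨ pair-harmIdx-∷ʳ k l a b (σᵀ n g) ⟩
    ⟪ harmIdx k (l ∷ʳ b) , σᵀ n g ∘ (_∷ʳ a) ⟫ +ℚ
      (⟪ harmIdx (k ∷ʳ a) l , σᵀ n g ∘ (_∷ʳ b) ⟫ +ℚ ⟪ harmIdx k l , σᵀ n g ∘ (_∷ʳ (a + b)) ⟫)
      ≡⟨ cong₂ _+ℚ_ left₁ (cong₂ _+ℚ_ left₂ left₃) ⟩
    total (summand X₁) +ℚ (total (summand X₂) +ℚ total (summand X₃))
      ≡⟨ sym right ⟩
    antidiag n (λ i j → ⟪ σIdx i (k ∷ʳ a) , (λ u → ⟪ σIdx j (l ∷ʳ b) , harmᵀ g u ⟫) ⟫) ∎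

leibniz-∷ʳ : ∀ {k l} a b → Leibniz k (l ∷ʳ b) → Leibniz (k ∷ʳ a) l → Leibniz k l → Leibniz (k ∷ʳ a) (l ∷ʳ b)
leibniz-∷ʳ = Leibniz-step.leibniz

leibniz-reverse : ∀ {k l} → Reverse k → Reverse l → Leibniz k l
leibniz-reverse []            _             = leibniz-[]ˡ _
leibniz-reverse (_ ∶ _ ∶ʳ _)  []            = leibniz-[]ʳ _
leibniz-reverse (k ∶ rk ∶ʳ a) (l ∶ rl ∶ʳ b) = leibniz-∷ʳ a b
  (leibniz-reverse rk (l ∶ rl ∶ʳ b)) (leibniz-reverse (k ∶ rk ∶ʳ a) rl) (leibniz-reverse rk rl)

leibniz : ∀ k l → Leibniz k l
leibniz k l = leibniz-reverse (reverseView k) (reverseView l)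

lemma2p1 : (n : ℕ) (k l : Index) → IsIndex k → IsIndex l →
    σ n (basis k * basis l) ≈ sumLC n (λ i → σ i (basis k) * σ (n ∸ i) (basis l))
lemma2p1 n k l _ _ =
  ≈-by-pairing {σ n (basis k * basis l)} {sumLC n (λ i → σ i (basis k) * σ (n ∸ i) (basis l))} paired
  where
  paired : ∀ g →
    ⟪ σ n (basis k * basis l) , g ⟫ ≡ ⟪ sumLC n (λ i → σ i (basis k) * σ (n ∸ i) (basis l)) , g ⟫
  paired g = begin
    ⟪ σ n (basis k * basis l) , g ⟫
      ≡⟨ pair-σ n (basis k * basis l) g ⟩
    ⟪ basis k * basis l , σᵀ n g ⟫
      ≡⟨ pair-basis-*-basis k l (σᵀ n g) ⟩
    ⟪ harmIdx k l , σᵀ n g ⟫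
      ≡⟨ leibniz k l n g ⟩
    antidiag n (λ i j → ⟪ σIdx i k , (λ u → ⟪ σIdx j l , harmᵀ g u ⟫) ⟫)
      ≡⟨ antidiag-cong n (λ i j → sym (pair-σ-basis-*-σ-basis i j k l g)) ⟩
    antidiag n (λ i j → ⟪ σ i (basis k) * σ j (basis l) , g ⟫)
      ≡⟨ sym (pair-sumLC n (λ i j → σ i (basis k) * σ j (basis l)) g) ⟩
    ⟪ sumLC n (λ i → σ i (basis k) * σ (n ∸ i) (basis l)) , g ⟫ ∎
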